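{- For all formulas $\varphi,\psi\in\mathcal{L}_{\Box\Diamond}(V)$, the following are provable in $\mathcal{GK}^c$: (T3) $(\Box\varphi\to\Diamond\varphi)\vee\Box\bot$; $(T^<_\Box)$ $((\Box\psi\to\Box\varphi)\to\Box\varphi)\to((\Box((\psi\to\varphi)\to\varphi)\to\Box\varphi)\to\Box\varphi)$; $(T^<_\Diamond)$ $((\Diamond\psi\to\Diamond\varphi)\to\Diamond\varphi)\to\Diamond((\psi\to\varphi)\to\varphi)$.
   Context: $V$ is a countable set of propositional variables. $\mathcal{L}_{\Box\Diamond}(V)$ is the set of formulas built from $V$ and $\bot$ with $\wedge,\vee,\rightarrow$ and unary $\Box,\Diamond$; $\top:=\bot\to\bot$, $\neg\varphi:=\varphi\to\bot$. $\mathcal{GK}^c$: Gödel–Dummett propositional calculus (intuitionistic calculus plus prelinearity $(\varphi\to\psi)\vee(\psi\to\varphi)$, modus ponens) over $\mathcal{L}_{\Box\Diamond}(V)$, plus axioms $\Box(\varphi\to\psi)\to(\Box\varphi\to\Box\psi)$, $\Diamond(\varphi\vee\psi)\to(\Diamond\varphi\vee\Diamond\psi)$, $\Diamond(\varphi\to\psi)\to(\Box\varphi\to\Diamond\psi)$, $(\Diamond\varphi\to\Box\psi)\to\Box(\varphi\to\psi)$, $\neg\Diamond\bot$, $\Box(\varphi\vee\psi)\to(\Box\varphi\vee\Diamond\psi)$, and rules applicable only to theorems: from $\varphi$ infer $\Box\varphi$; from $\varphi\to\psi$ infer $\Diamond\varphi\to\Diamond\psi$. -}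

module Defs where

open import Data.Nat using (ℕ)
open import Data.Product using (_×_)

-- Propositional variables: V is countable; we take V = ℕ.
Var : Set
Var = ℕ

infixr 5 _⇒_
infixr 6 _∨_
infixr 7 _∧_

data Form : Set where
  var : Var → Form
  ⊥'  : Form
  _∧_ : Form → Form → Form
  _∨_ : Form → Form → Form
  _⇒_ : Form → Form → Form
  □   : Form → Form
  ◇   : Form → Form

⊤' : Form
⊤' = ⊥' ⇒ ⊥'

¬' : Form → Form
¬' φ = φ ⇒ ⊥'

-- Theoremhood in GK^c: Hilbert-style intuitionistic propositional calculus
-- (standard axiom schemes), prelinearity, modus ponens, the modal axioms,
-- and the two modal rules (applicable only to theorems, which is automatic
-- since ⊢ is theoremhood with no hypotheses).
data ⊢_ : Form → Set where
  ax-K    : ∀ {φ ψ} → ⊢ (φ ⇒ ψ ⇒ φ)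
  ax-S    : ∀ {φ ψ χ} → ⊢ ((φ ⇒ ψ ⇒ χ) ⇒ (φ ⇒ ψ) ⇒ φ ⇒ χ)
  ax-∧E₁  : ∀ {φ ψ} → ⊢ (φ ∧ ψ ⇒ φ)
  ax-∧E₂  : ∀ {φ ψ} → ⊢ (φ ∧ ψ ⇒ ψ)
  ax-∧I   : ∀ {φ ψ} → ⊢ (φ ⇒ ψ ⇒ φ ∧ ψ)
  ax-∨I₁  : ∀ {φ ψ} → ⊢ (φ ⇒ φ ∨ ψ)
  ax-∨I₂  : ∀ {φ ψ} → ⊢ (ψ ⇒ φ ∨ ψ)
  ax-∨E   : ∀ {φ ψ χ} → ⊢ ((φ ⇒ χ) ⇒ (ψ ⇒ χ) ⇒ φ ∨ ψ ⇒ χ)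
  ax-⊥E   : ∀ {φ} → ⊢ (⊥' ⇒ φ)
  ax-lin  : ∀ {φ ψ} → ⊢ ((φ ⇒ ψ) ∨ (ψ ⇒ φ))
  ax-□K   : ∀ {φ ψ} → ⊢ (□ (φ ⇒ ψ) ⇒ □ φ ⇒ □ ψ)
  ax-◇∨   : ∀ {φ ψ} → ⊢ (◇ (φ ∨ ψ) ⇒ ◇ φ ∨ ◇ ψ)
  ax-◇⇒   : ∀ {φ ψ} → ⊢ (◇ (φ ⇒ ψ) ⇒ □ φ ⇒ ◇ ψ)
  ax-FS   : ∀ {φ ψ} → ⊢ ((◇ φ ⇒ □ ψ) ⇒ □ (φ ⇒ ψ))
  ax-◇⊥   : ⊢ ¬' (◇ ⊥')
  ax-□∨   : ∀ {φ ψ} → ⊢ (□ (φ ∨ ψ) ⇒ □ φ ∨ ◇ ψ)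
  mp      : ∀ {φ ψ} → ⊢ (φ ⇒ ψ) → ⊢ φ → ⊢ ψ
  nec     : ∀ {φ} → ⊢ φ → ⊢ □ φ
  ◇-mono  : ∀ {φ ψ} → ⊢ (φ ⇒ ψ) → ⊢ (◇ φ ⇒ ◇ ψ)

-- T3: necessitation applied to the tautology ⊥ ∨ ⊤ and axiom □(φ ∨ ψ) → □φ ∨ ◇ψ
-- give □⊥ ∨ ◇⊤, and ◇⊤ yields □φ → ◇φ through ◇(φ → φ).
-- T<□ is the functoriality of the continuation (− → □φ) → □φ along the theorem
-- □ψ → □((ψ → φ) → φ).
-- T<◇: prelinearity gives the tautology (ψ → φ) ∨ ((ψ → φ) → φ), which the same
-- □∨-axiom turns into □(ψ → φ) ∨ ◇((ψ → φ) → φ); the first disjunct yields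
-- ◇ψ → ◇φ, so the hypothesis produces ◇φ and hence ◇((ψ → φ) → φ).
module Submission where

open import Defs
open import Data.Product using (_×_; _,_)
open import Data.List using (List; []; _∷_)
open import Data.List.Membership.Propositional using (_∈_)
open import Data.List.Relation.Unary.Any using (here; there)
open import Relation.Binary.PropositionalEquality using (refl)

⇒-refl : ∀ {φ} → ⊢ (φ ⇒ φ)
⇒-refl {φ} = mp (mp ax-S ax-K) (ax-K {φ} {φ})

infix 2 _⊩_
infixl 5 _∙_

data _⊩_ (Γ : List Form) : Form → Set where
  hyp : ∀ {φ} → φ ∈ Γ → Γ ⊩ φ
  thm : ∀ {φ} → ⊢ φ → Γ ⊩ φ
  _∙_ : ∀ {φ ψ} → Γ ⊩ (φ ⇒ ψ) → Γ ⊩ φ → Γ ⊩ ψ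

deduction : ∀ {Γ φ ψ} → (φ ∷ Γ) ⊩ ψ → Γ ⊩ (φ ⇒ ψ)
deduction (hyp (here refl)) = thm ⇒-refl
deduction (hyp (there p))   = thm ax-K ∙ hyp p
deduction (thm t)           = thm ax-K ∙ thm t
deduction (f ∙ x)           = thm ax-S ∙ deduction f ∙ deduction x

closed : ∀ {φ} → [] ⊩ φ → ⊢ φ
closed (hyp ())
closed (thm t) = t
closed (f ∙ x) = mp (closed f) (closed x)

#0 : ∀ {Γ φ} → (φ ∷ Γ) ⊩ φ
#0 = hyp (here refl)

#1 : ∀ {Γ φ ψ} → (ψ ∷ φ ∷ Γ) ⊩ φ
#1 = hyp (there (here refl))

∨-elim : ∀ {φ ψ χ} → ⊢ (φ ⇒ χ) → ⊢ (ψ ⇒ χ) → ⊢ (φ ∨ ψ) → ⊢ χ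
∨-elim f g d = mp (mp (mp ax-∨E f) g) d

⇒-trans : ∀ {φ ψ χ} → ⊢ (φ ⇒ ψ) → ⊢ (ψ ⇒ χ) → ⊢ (φ ⇒ χ)
⇒-trans f g = closed (deduction (thm g ∙ (thm f ∙ #0)))

⇒-apply : ∀ {φ ψ} → ⊢ (φ ⇒ (φ ⇒ ψ) ⇒ ψ)
⇒-apply = closed (deduction (deduction (#0 ∙ #1)))

continuation-mono : ∀ {φ ψ χ} → ⊢ (φ ⇒ ψ) →
  ⊢ (((φ ⇒ χ) ⇒ χ) ⇒ (ψ ⇒ χ) ⇒ χ)
continuation-mono f = closed (deduction (deduction (#1 ∙ deduction (#1 ∙ (thm f ∙ #0)))))

⇒-∨-⇒-apply : ∀ {φ ψ} → ⊢ ((ψ ⇒ φ) ∨ ((ψ ⇒ φ) ⇒ φ))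
⇒-∨-⇒-apply {φ} {ψ} = ∨-elim collapse apply (ax-lin {ψ ⇒ φ} {ψ})
  where
  collapse : ⊢ (((ψ ⇒ φ) ⇒ ψ) ⇒ (ψ ⇒ φ) ∨ ((ψ ⇒ φ) ⇒ φ))
  collapse = closed (deduction (thm ax-∨I₂ ∙ deduction (#0 ∙ (#1 ∙ #0))))
  apply : ⊢ ((ψ ⇒ (ψ ⇒ φ)) ⇒ (ψ ⇒ φ) ∨ ((ψ ⇒ φ) ⇒ φ))
  apply = closed (deduction (thm ax-∨I₁ ∙ deduction (#1 ∙ #0 ∙ #0)))

□-mono : ∀ {φ ψ} → ⊢ (φ ⇒ ψ) → ⊢ (□ φ ⇒ □ ψ)
□-mono f = mp ax-□K (nec f)

□∨◇ : ∀ {φ ψ} → ⊢ (φ ∨ ψ) → ⊢ (□ φ ∨ ◇ ψ)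
□∨◇ d = mp ax-□∨ (nec d)

◇-K : ∀ {φ ψ} → ⊢ (□ (φ ⇒ ψ) ⇒ ◇ φ ⇒ ◇ ψ)
◇-K = closed (deduction (deduction (thm ax-◇⇒ ∙ (thm (◇-mono ⇒-apply) ∙ #0) ∙ #1)))

◇⊤⇒□⇒◇ : ∀ {φ} → ⊢ (◇ ⊤' ⇒ □ φ ⇒ ◇ φ)
◇⊤⇒□⇒◇ = closed (deduction (thm ax-◇⇒ ∙ (thm (◇-mono (mp ax-K ⇒-refl)) ∙ #0)))

□⊥∨◇⊤ : ⊢ (□ ⊥' ∨ ◇ ⊤')
□⊥∨◇⊤ = □∨◇ (mp ax-∨I₂ ⇒-refl)

T3 : ∀ φ → ⊢ ((□ φ ⇒ ◇ φ) ∨ □ ⊥')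
T3 φ = ∨-elim ax-∨I₂ (⇒-trans ◇⊤⇒□⇒◇ ax-∨I₁) □⊥∨◇⊤

T<□ : ∀ φ ψ → ⊢ (((□ ψ ⇒ □ φ) ⇒ □ φ) ⇒ ((□ ((ψ ⇒ φ) ⇒ φ) ⇒ □ φ) ⇒ □ φ))
T<□ φ ψ = continuation-mono (□-mono ⇒-apply)

◇-mono∨◇⇒-apply : ∀ {φ ψ} → ⊢ ((◇ ψ ⇒ ◇ φ) ∨ ◇ ((ψ ⇒ φ) ⇒ φ))
◇-mono∨◇⇒-apply = ∨-elim (⇒-trans ◇-K ax-∨I₁) ax-∨I₂ (□∨◇ ⇒-∨-⇒-apply)

T<◇ : ∀ φ ψ → ⊢ (((◇ ψ ⇒ ◇ φ) ⇒ ◇ φ) ⇒ ◇ ((ψ ⇒ φ) ⇒ φ))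
T<◇ φ ψ = ∨-elim viaMono ax-K ◇-mono∨◇⇒-apply
  where
  viaMono : ⊢ ((◇ ψ ⇒ ◇ φ) ⇒ ((◇ ψ ⇒ ◇ φ) ⇒ ◇ φ) ⇒ ◇ ((ψ ⇒ φ) ⇒ φ))
  viaMono = closed (deduction (deduction (thm (◇-mono ax-K) ∙ (#0 ∙ #1))))

lemma3 : ∀ (φ ψ : Form) →
    (⊢ ((□ φ ⇒ ◇ φ) ∨ □ ⊥'))
    × (⊢ (((□ ψ ⇒ □ φ) ⇒ □ φ) ⇒ ((□ ((ψ ⇒ φ) ⇒ φ) ⇒ □ φ) ⇒ □ φ)))
    × (⊢ (((◇ ψ ⇒ ◇ φ) ⇒ ◇ φ) ⇒ ◇ ((ψ ⇒ φ) ⇒ φ)))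
lemma3 φ ψ = T3 φ , T<□ φ ψ , T<◇ φ ψ
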